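{- Let $n\ge 2$ and let $K_n$ be the complete graph on vertex set $[n]$. Let $\mathcal A=\{\mathbf a\in\mathbb Z^n : a_1,\ldots,a_{n-2}\in\{0,\ldots,n-1\},\ a_{n-1}=0\}$. Then for every $\mathbf d\in\mathbb Z^n$ there exists a unique $\mathbf a\in\mathcal A$ with $\mathbf d-\mathbf a\in\mathrm{Image}(\Delta_{K_n})$, and it is given by $a_j=(d_j-d_{n-1})\bmod n$ for $j\in[n-2]$, $a_{n-1}=0$, and $a_n=\deg(\mathbf d)-a_1-\cdots-a_{n-2}$.
   Context: $\deg(\mathbf d)=d_1+\cdots+d_n$; $x\bmod n$ is the element of $\{0,\ldots,n-1\}$ congruent to $x$ modulo $n$. $\Delta_{K_n}=nI-\mathbf 1\mathbf 1^T$ is the Laplacian of $K_n$ (degree matrix minus adjacency matrix), viewed as a map $\mathbb Z^n\to\mathbb Z^n$. -}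

module Defs where

open import Data.Nat using (ℕ; zero; suc; _<?_)
open import Data.Fin using (Fin; zero; suc; toℕ; fromℕ; inject₁)
open import Data.Integer using (ℤ; +_; _+_; _-_; _*_; _≤_; _<_)
open import Data.Bool using (if_then_else_)
open import Data.Product using (Σ; _×_)
open import Relation.Nullary.Decidable using (⌊_⌋)
open import Relation.Binary.PropositionalEquality using (_≡_)

-- Vectors in ℤ^k are functions Fin k → ℤ; coordinate i (0-based) is coordinate i+1 of the paper.
Vecℤ : ℕ → Set
Vecℤ k = Fin k → ℤ

sumℤ : ∀ {k} → Vecℤ k → ℤ
sumℤ {zero}  f = + 0
sumℤ {suc k} f = f zero + sumℤ (λ i → f (suc i))

deg : ∀ {k} → Vecℤ k → ℤ
deg = sumℤ

-- sum of the coordinates with 0-based index < b (paper: a_1 + ... + a_b)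
sumBelow : ∀ {k} → ℕ → Vecℤ k → ℤ
sumBelow b f = sumℤ (λ j → if ⌊ toℕ j <? b ⌋ then f j else + 0)

_-ᵥ_ : ∀ {k} → Vecℤ k → Vecℤ k → Vecℤ k
(f -ᵥ g) i = f i - g i

ΔK : (k : ℕ) → Vecℤ k → Vecℤ k
ΔK k x i = (+ k) * x i - sumℤ x

InImageΔ : (k : ℕ) → Vecℤ k → Set
InImageΔ k v = Σ (Vecℤ k) λ x → ∀ i → ΔK k x i ≡ v i

-- For n = m + 2: index of a_{n-1} (0-based m) and of a_n (0-based m+1)
pen : (m : ℕ) → Fin (suc (suc m))
pen m = inject₁ (fromℕ m)

lst : (m : ℕ) → Fin (suc (suc m))
lst m = fromℕ (suc m)

InA : (m : ℕ) → Vecℤ (suc (suc m)) → Set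
InA m a = (∀ (j : Fin (suc (suc m))) → toℕ j Data.Nat.< m →
             (+ 0 ≤ a j) × (a j < + suc (suc m)))
          × (a (pen m) ≡ + 0)

-- A vector lies in the image of Δ = nI − 11ᵀ exactly when its coordinates sum to 0 and are
-- pairwise congruent modulo n; if the sum is 0, congruence of all coordinates but one already
-- suffices. So d − a ∈ Im Δ with a_{n−1} = 0 forces a_j ≡ d_j − d_{n−1} (mod n) for j ≤ n − 2,
-- which pins a_j down inside {0, …, n − 1}, and deg a = deg d pins down a_n; conversely the
-- vector defined this way satisfies both conditions.
module Submission where

open import Defs
open import Data.Nat using (ℕ; suc; _<_)
open import Data.Fin using (Fin; toℕ)
open import Data.Integer using (ℤ; +_; _-_)
open import Data.Integer.DivMod using (_%ℕ_)
open import Data.Product using (Σ; _×_)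
open import Relation.Binary.PropositionalEquality using (_≡_)

open import Data.Bool using (if_then_else_)
open import Data.Empty using (⊥-elim)
open import Data.Fin using (zero; suc; fromℕ; _≟_; punchIn)
import Data.Fin.Properties as FinP
open import Data.Integer using (_+_; _*_; -_; _≤_; +≤+; +<+; ∣_∣)
import Data.Integer as ℤ
import Data.Integer.Properties as ℤP
open import Algebra.Properties.Semiring.Sum ℤP.+-*-semiring
  using (sum; sum-cong-≗; ∑-distrib-+; *-distribˡ-sum; sum-remove; sum-replicate-zero)
open import Data.Integer.DivMod using (_/ℕ_; a≡a%ℕn+[a/ℕn]*n; n%ℕd<d)
open import Data.Integer.Tactic.RingSolver using (solve-∀)
import Data.Nat as ℕ
import Data.Nat.Properties as ℕP
open import Data.Product using (∃; _,_)
open import Data.Sum using (_⊎_; inj₁; inj₂)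
open import Data.Vec.Functional using (updateAt)
open import Data.Vec.Functional.Properties using (updateAt-updates; updateAt-minimal)
open import Function using (_∘_)
open import Relation.Binary.PropositionalEquality
  using (_≢_; _≗_; refl; sym; trans; cong; cong₂; subst; module ≡-Reasoning)
open import Relation.Nullary using (yes; no)
open import Relation.Nullary.Decidable using (⌊_⌋; isYes≗does)

sumℤ≡sum : ∀ {k} (f : Vecℤ k) → sumℤ f ≡ sum f
sumℤ≡sum {ℕ.zero} f = refl
sumℤ≡sum {suc k}  f = cong (λ t → f zero + t) (sumℤ≡sum (f ∘ suc))

sumℤ-cong : ∀ {k} {f g : Vecℤ k} → f ≗ g → sumℤ f ≡ sumℤ g
sumℤ-cong {f = f} {g} f≗g
  rewrite sumℤ≡sum f | sumℤ≡sum g = sum-cong-≗ f≗g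

sumℤ-+ : ∀ {k} (f g : Vecℤ k) → sumℤ (λ i → f i + g i) ≡ sumℤ f + sumℤ g
sumℤ-+ f g rewrite sumℤ≡sum f | sumℤ≡sum g | sumℤ≡sum (λ i → f i + g i) =
  ∑-distrib-+ f g

sumℤ-neg : ∀ {k} (f : Vecℤ k) → sumℤ (λ i → - f i) ≡ - sumℤ f
sumℤ-neg {ℕ.zero} f = refl
sumℤ-neg {suc k}  f =
  trans (cong (λ t → - f zero + t) (sumℤ-neg (f ∘ suc))) (sym (ℤP.neg-distrib-+ (f zero) _))

sumℤ-- : ∀ {k} (f g : Vecℤ k) → sumℤ (f -ᵥ g) ≡ sumℤ f - sumℤ g
sumℤ-- f g = trans (sumℤ-+ f (-_ ∘ g)) (cong (λ t → sumℤ f + t) (sumℤ-neg g))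

sumℤ-*ˡ : ∀ {k} c (f : Vecℤ k) → sumℤ (λ i → c * f i) ≡ c * sumℤ f
sumℤ-*ˡ c f rewrite sumℤ≡sum f | sumℤ≡sum (λ i → c * f i) =
  sym (*-distribˡ-sum c f)

sumℤ-const : ∀ k c → sumℤ {k} (λ _ → c) ≡ + k * c
sumℤ-const ℕ.zero  c = refl
sumℤ-const (suc k) c = trans (cong (λ t → c + t) (sumℤ-const k c)) (sym (ℤP.suc-* (+ k) c))

sumℤ-supported : ∀ {k} (s : Fin k) (f : Vecℤ k) →
                 (∀ j → j ≢ s → f j ≡ + 0) → sumℤ f ≡ f s
sumℤ-supported {suc k} s f off = begin
  sumℤ f                                   ≡⟨ sumℤ≡sum f ⟩
  sum f                                    ≡⟨ sum-remove f ⟩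
  f s + sum (f ∘ punchIn s)                ≡⟨ cong (λ t → f s + t) (sum-cong-≗ (off _ ∘ FinP.punchInᵢ≢i s)) ⟩
  f s + sum {k} (λ _ → + 0)                ≡⟨ cong (λ t → f s + t) (sum-replicate-zero k) ⟩
  f s + + 0                                ≡⟨ ℤP.+-identityʳ (f s) ⟩
  f s                                      ∎
  where open ≡-Reasoning

≡-at-from-sumℤ : ∀ {k} (s : Fin k) {f g : Vecℤ k} →
                 (∀ j → j ≢ s → f j ≡ g j) → sumℤ f ≡ sumℤ g → f s ≡ g s
≡-at-from-sumℤ s {f} {g} off Σf≡Σg = ℤP.i-j≡0⇒i≡j (f s) (g s) (begin
  f s - g s           ≡⟨ sumℤ-supported s (f -ᵥ g) (λ j j≢s → ℤP.i≡j⇒i-j≡0 (off j j≢s)) ⟨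
  sumℤ (f -ᵥ g)       ≡⟨ sumℤ-- f g ⟩
  sumℤ f - sumℤ g     ≡⟨ ℤP.i≡j⇒i-j≡0 Σf≡Σg ⟩
  + 0                 ∎)
  where open ≡-Reasoning

ΔK-sum : ∀ k (x : Vecℤ k) → sumℤ (ΔK k x) ≡ + 0
ΔK-sum k x = begin
  sumℤ (ΔK k x)                                     ≡⟨ sumℤ-- (λ i → + k * x i) (λ _ → sumℤ x) ⟩
  sumℤ (λ i → + k * x i) - sumℤ {k} (λ _ → sumℤ x)  ≡⟨ cong₂ _-_ (sumℤ-*ˡ (+ k) x) (sumℤ-const k (sumℤ x)) ⟩
  + k * sumℤ x - + k * sumℤ x                       ≡⟨ ℤP.+-inverseʳ (+ k * sumℤ x) ⟩
  + 0                                               ∎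
  where open ≡-Reasoning

ΔK-sub : ∀ k (x y : Vecℤ k) i → ΔK k (x -ᵥ y) i ≡ ΔK k x i - ΔK k y i
ΔK-sub k x y i = begin
  + k * (x i - y i) - sumℤ (x -ᵥ y)            ≡⟨ cong (λ t → + k * (x i - y i) - t) (sumℤ-- x y) ⟩
  + k * (x i - y i) - (sumℤ x - sumℤ y)        ≡⟨ linear (+ k) (x i) (y i) (sumℤ x) (sumℤ y) ⟩
  (+ k * x i - sumℤ x) - (+ k * y i - sumℤ y)  ∎
  where
  open ≡-Reasoning
  linear : ∀ K a b A B → K * (a - b) - (A - B) ≡ (K * a - A) - (K * b - B)
  linear = solve-∀

ΔK-diff : ∀ k (x : Vecℤ k) i j → ΔK k x i - ΔK k x j ≡ + k * (x i - x j)
ΔK-diff k x i j = cancel (+ k) (x i) (x j) (sumℤ x)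
  where
  cancel : ∀ K a b S → (K * a - S) - (K * b - S) ≡ K * (a - b)
  cancel = solve-∀

∈imageΔ-sum : ∀ {k} {v : Vecℤ k} → InImageΔ k v → sumℤ v ≡ + 0
∈imageΔ-sum {k} (x , Δx≡v) = trans (sym (sumℤ-cong Δx≡v)) (ΔK-sum k x)

∈imageΔ-congruent : ∀ {k} {v : Vecℤ k} → InImageΔ k v → ∀ i j → ∃ λ t → v i - v j ≡ + k * t
∈imageΔ-congruent {k} (x , Δx≡v) i j =
  x i - x j , trans (sym (cong₂ _-_ (Δx≡v i) (Δx≡v j))) (ΔK-diff k x i j)

∈imageΔ-sub : ∀ {k} {d a a′ : Vecℤ k} →
              InImageΔ k (d -ᵥ a) → InImageΔ k (d -ᵥ a′) → InImageΔ k (a′ -ᵥ a)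
∈imageΔ-sub {k} {d} {a} {a′} (x , Δx≡d-a) (y , Δy≡d-a′) = x -ᵥ y , λ i → begin
  ΔK k (x -ᵥ y) i                  ≡⟨ ΔK-sub k x y i ⟩
  ΔK k x i - ΔK k y i              ≡⟨ cong₂ _-_ (Δx≡d-a i) (Δy≡d-a′ i) ⟩
  (d i - a i) - (d i - a′ i)       ≡⟨ swap (d i) (a i) (a′ i) ⟩
  a′ i - a i                       ∎
  where
  open ≡-Reasoning
  swap : ∀ δ α α′ → (δ - α) - (δ - α′) ≡ α′ - α
  swap = solve-∀

-- The witness is q shifted at s so that its sum is −c; coordinate s then matches because
-- both ΔK k x and v have sum 0.
∈imageΔ-criterion : ∀ {k} (s : Fin k) (c : ℤ) (q v : Vecℤ k) →
                    sumℤ v ≡ + 0 → (∀ j → j ≢ s → v j ≡ c + + k * q j) → InImageΔ k v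
∈imageΔ-criterion {k} s c q v Σv≡0 congruent = x , Δx≡v
  where
  open ≡-Reasoning

  x : Vecℤ k
  x = updateAt q s (λ t → t - (c + sumℤ q))

  Σx≡-c : sumℤ x ≡ - c
  Σx≡-c = begin
    sumℤ x                                    ≡⟨ split (sumℤ x) (sumℤ q) ⟩
    (sumℤ x - sumℤ q) + sumℤ q                ≡⟨ cong (λ t → t + sumℤ q) (sumℤ-- x q) ⟨
    sumℤ (x -ᵥ q) + sumℤ q                    ≡⟨ cong (λ t → t + sumℤ q) (sumℤ-supported s (x -ᵥ q) unchanged) ⟩
    (x s - q s) + sumℤ q                      ≡⟨ cong (λ t → (t - q s) + sumℤ q) (updateAt-updates s q) ⟩
    (q s - (c + sumℤ q) - q s) + sumℤ q       ≡⟨ collapse (q s) c (sumℤ q) ⟩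
    - c                                       ∎
    where
    unchanged : ∀ j → j ≢ s → x j - q j ≡ + 0
    unchanged j j≢s = ℤP.i≡j⇒i-j≡0 (updateAt-minimal j s q j≢s)
    split : ∀ X Q → X ≡ (X - Q) + Q
    split = solve-∀
    collapse : ∀ a c Q → (a - (c + Q) - a) + Q ≡ - c
    collapse = solve-∀

  Δx≡v-off : ∀ j → j ≢ s → ΔK k x j ≡ v j
  Δx≡v-off j j≢s = begin
    + k * x j - sumℤ x        ≡⟨ cong₂ (λ t S → + k * t - S) (updateAt-minimal j s q j≢s) Σx≡-c ⟩
    + k * q j - - c           ≡⟨ reorder (+ k * q j) c ⟩
    c + + k * q j             ≡⟨ congruent j j≢s ⟨
    v j                       ∎
    where
    reorder : ∀ a c → a - - c ≡ c + a
    reorder = solve-∀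

  Δx≡v : ∀ j → ΔK k x j ≡ v j
  Δx≡v j with j ≟ s
  ... | yes refl = ≡-at-from-sumℤ s Δx≡v-off (trans (ΔK-sum k x) (sym Σv≡0))
  ... | no j≢s   = Δx≡v-off j j≢s

congruent-residues-≡ : ∀ {n} {x y : ℤ} t → + 0 ≤ x → x ℤ.< + n → + 0 ≤ y → y ℤ.< + n →
                       x - y ≡ + n * t → x ≡ y
congruent-residues-≡ {n} {+ a} {+ b} t (+≤+ _) (+<+ a<n) (+≤+ _) (+<+ b<n) eq =
  ℤP.i-j≡0⇒i≡j (+ a) (+ b) (trans eq (trans (cong (λ u → + n * u) t≡0) (ℤP.*-zeroʳ (+ n))))
  where
  n*∣t∣<n : n ℕ.* ∣ t ∣ ℕ.< n ℕ.* 1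
  n*∣t∣<n = begin-strict
    n ℕ.* ∣ t ∣        ≡⟨ ℤP.abs-* (+ n) t ⟨
    ∣ + n * t ∣        ≡⟨ cong ∣_∣ eq ⟨
    ∣ + a - + b ∣      ≡⟨ cong ∣_∣ (ℤP.m-n≡m⊖n a b) ⟩
    ∣ a ℤ.⊖ b ∣        ≤⟨ ℤP.∣m⊝n∣≤m⊔n a b ⟩
    a ℕ.⊔ b            <⟨ ℕP.⊔-lub a<n b<n ⟩
    n                  ≡⟨ ℕP.*-identityʳ n ⟨
    n ℕ.* 1            ∎
    where open ℕP.≤-Reasoning
  t≡0 : t ≡ + 0
  t≡0 = ℤP.∣i∣≡0⇒i≡0 (ℕP.n<1⇒n≡0 (ℕP.*-cancelˡ-< n ∣ t ∣ 1 n*∣t∣<n))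

module _ {m : ℕ} where

  toℕ-pen : toℕ (pen m) ≡ m
  toℕ-pen = trans (FinP.toℕ-inject₁ (fromℕ m)) (FinP.toℕ-fromℕ m)

  toℕ-lst : toℕ (lst m) ≡ suc m
  toℕ-lst = FinP.toℕ-fromℕ (suc m)

  pen≢lst : pen m ≢ lst m
  pen≢lst pen≡lst = ℕP.1+n≢n (trans (sym toℕ-lst) (trans (sym (cong toℕ pen≡lst)) toℕ-pen))

  below⇒≢lst : {j : Fin (suc (suc m))} → toℕ j < m → j ≢ lst m
  below⇒≢lst j<m refl = ℕP.<-asym (ℕP.n<1+n m) (subst (ℕ._< m) toℕ-lst j<m)

  ≢lst⇒below⊎pen : {j : Fin (suc (suc m))} → j ≢ lst m → toℕ j < m ⊎ j ≡ pen m
  ≢lst⇒below⊎pen {j} j≢lst with ℕP.m≤n⇒m<n∨m≡n (ℕ.s≤s⁻¹ j<1+m)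
    where
    j<1+m : toℕ j < suc m
    j<1+m = ℕP.≤∧≢⇒< (ℕ.s≤s⁻¹ (FinP.toℕ<n j))
                     (λ j≡1+m → j≢lst (FinP.toℕ-injective (trans j≡1+m (sym toℕ-lst))))
  ... | inj₁ j<m = inj₁ j<m
  ... | inj₂ j≡m = inj₂ (FinP.toℕ-injective (trans j≡m (sym toℕ-pen)))

sumBelow-cong : ∀ {k} b {f g : Vecℤ k} → (∀ j → toℕ j < b → f j ≡ g j) → sumBelow b f ≡ sumBelow b g
sumBelow-cong b {f} {g} f≡g = sumℤ-cong masked
  where
  masked : ∀ j → (if ⌊ toℕ j ℕ.<? b ⌋ then f j else + 0) ≡ (if ⌊ toℕ j ℕ.<? b ⌋ then g j else + 0)
  masked j with toℕ j ℕ.<? b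
  ... | yes j<b = f≡g j j<b
  ... | no  _   = refl

sumBelow-suc : ∀ {k} b (f : Vecℤ (suc k)) → sumBelow (suc b) f ≡ f zero + sumBelow b (f ∘ suc)
sumBelow-suc b f = cong (λ t → f zero + t) (sumℤ-cong λ i →
  cong (λ β → if β then f (suc i) else + 0) (⌊<?⌋-suc (toℕ i)))
  where
  ⌊<?⌋-suc : ∀ a → ⌊ suc a ℕ.<? suc b ⌋ ≡ ⌊ a ℕ.<? b ⌋
  ⌊<?⌋-suc a = trans (isYes≗does (suc a ℕ.<? suc b)) (sym (isYes≗does (a ℕ.<? b)))

sumℤ-split : ∀ m (f : Vecℤ (suc (suc m))) → sumℤ f ≡ sumBelow m f + f (pen m) + f (lst m)
sumℤ-split ℕ.zero    f = tidy (f zero) (f (suc zero))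
  where
  -- sumBelow 0 f computes to + 0 + (+ 0 + + 0).
  tidy : ∀ a b → a + (b + + 0) ≡ (+ 0 + (+ 0 + + 0)) + a + b
  tidy = solve-∀
sumℤ-split (suc m) f = begin
  f zero + sumℤ (f ∘ suc)
    ≡⟨ cong (λ t → f zero + t) (sumℤ-split m (f ∘ suc)) ⟩
  f zero + (sumBelow m (f ∘ suc) + f (pen (suc m)) + f (lst (suc m)))
    ≡⟨ reassoc (f zero) _ _ _ ⟩
  (f zero + sumBelow m (f ∘ suc)) + f (pen (suc m)) + f (lst (suc m))
    ≡⟨ cong (λ t → t + f (pen (suc m)) + f (lst (suc m))) (sumBelow-suc m f) ⟨
  sumBelow (suc m) f + f (pen (suc m)) + f (lst (suc m))
    ∎
  where
  open ≡-Reasoning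
  reassoc : ∀ a s p l → a + (s + p + l) ≡ (a + s) + p + l
  reassoc = solve-∀

InA-unique : ∀ m {d a a′ : Vecℤ (suc (suc m))} → InA m a → InA m a′ →
             InImageΔ (suc (suc m)) (d -ᵥ a) → InImageΔ (suc (suc m)) (d -ᵥ a′) →
             ∀ i → a′ i ≡ a i
InA-unique m {d} {a} {a′} (a-bounded , a-pen) (a′-bounded , a′-pen) d-a∈Im d-a′∈Im = agree
  where
  a′-a∈Im : InImageΔ (suc (suc m)) (a′ -ᵥ a)
  a′-a∈Im = ∈imageΔ-sub {d = d} d-a∈Im d-a′∈Im

  below : ∀ j → toℕ j < m → a′ j ≡ a j
  below j j<m with ∈imageΔ-congruent a′-a∈Im j (pen m) | a′-bounded j j<m | a-bounded j j<m
  ... | t , eq | 0≤a′j , a′j<n | 0≤aj , aj<n = congruent-residues-≡ t 0≤a′j a′j<n 0≤aj aj<n (begin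
    a′ j - a j                                ≡⟨ ℤP.+-identityʳ (a′ j - a j) ⟨
    (a′ j - a j) - (+ 0 - + 0)                ≡⟨ cong₂ (λ p q → (a′ j - a j) - (p - q)) a′-pen a-pen ⟨
    (a′ j - a j) - (a′ (pen m) - a (pen m))   ≡⟨ eq ⟩
    + suc (suc m) * t                         ∎)
    where open ≡-Reasoning

  off-lst : ∀ j → j ≢ lst m → a′ j ≡ a j
  off-lst j j≢lst with ≢lst⇒below⊎pen j≢lst
  ... | inj₁ j<m  = below j j<m
  ... | inj₂ refl = trans a′-pen (sym a-pen)

  Σa′≡Σa : sumℤ a′ ≡ sumℤ a
  Σa′≡Σa = ℤP.i-j≡0⇒i≡j _ _ (trans (sym (sumℤ-- a′ a)) (∈imageΔ-sum a′-a∈Im))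

  agree : ∀ i → a′ i ≡ a i
  agree i with i ≟ lst m
  ... | yes refl = ≡-at-from-sumℤ (lst m) off-lst Σa′≡Σa
  ... | no i≢lst = off-lst i i≢lst

module Reduction (m : ℕ) (d : Vecℤ (suc (suc m))) where

  residue : Vecℤ (suc (suc m))
  residue j = + ((d j - d (pen m)) %ℕ suc (suc m))

  reduced : Vecℤ (suc (suc m))
  reduced j with j ≟ lst m
  ... | yes _ = deg d - sumBelow m residue
  ... | no  _ = residue j

  reduced-off-lst : ∀ {j} → j ≢ lst m → reduced j ≡ residue j
  reduced-off-lst {j} j≢lst with j ≟ lst m
  ... | yes j≡lst = ⊥-elim (j≢lst j≡lst)
  ... | no  _     = refl

  reduced-below : ∀ {j} → toℕ j < m → reduced j ≡ residue j
  reduced-below = reduced-off-lst ∘ below⇒≢lst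

  reduced-pen : reduced (pen m) ≡ + 0
  reduced-pen = trans (reduced-off-lst pen≢lst)
                      (cong (λ t → + (t %ℕ suc (suc m))) (ℤP.+-inverseʳ (d (pen m))))

  reduced-lst : reduced (lst m) ≡ deg d - sumBelow m reduced
  reduced-lst with lst m ≟ lst m
  ... | yes _       = cong (λ t → deg d - t) (sumBelow-cong m (λ _ → sym ∘ reduced-below))
  ... | no lst≢lst = ⊥-elim (lst≢lst refl)

  reduced∈A : InA m reduced
  reduced∈A = bounded , reduced-pen
    where
    bounded : ∀ j → toℕ j < m → (+ 0 ≤ reduced j) × (reduced j ℤ.< + suc (suc m))
    bounded j j<m rewrite reduced-below j<m =
      +≤+ ℕ.z≤n , +<+ (n%ℕd<d (d j - d (pen m)) (suc (suc m)))

  sumℤ-reduced : sumℤ reduced ≡ deg d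
  sumℤ-reduced = begin
    sumℤ reduced
      ≡⟨ sumℤ-split m reduced ⟩
    sumBelow m reduced + reduced (pen m) + reduced (lst m)
      ≡⟨ cong₂ (λ p l → sumBelow m reduced + p + l) reduced-pen reduced-lst ⟩
    sumBelow m reduced + + 0 + (deg d - sumBelow m reduced)
      ≡⟨ cancel (sumBelow m reduced) (deg d) ⟩
    deg d
      ∎
    where
    open ≡-Reasoning
    cancel : ∀ S D → S + + 0 + (D - S) ≡ D
    cancel = solve-∀

  d-reduced∈imageΔ : InImageΔ (suc (suc m)) (d -ᵥ reduced)
  d-reduced∈imageΔ = ∈imageΔ-criterion (lst m) c quotient (d -ᵥ reduced) Σ≡0 congruent
    where
    open ≡-Reasoning
    c : ℤ
    c = d (pen m)
    quotient : Vecℤ (suc (suc m))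
    quotient j = (d j - c) /ℕ suc (suc m)

    Σ≡0 : sumℤ (d -ᵥ reduced) ≡ + 0
    Σ≡0 = trans (sumℤ-- d reduced) (trans (cong (λ t → deg d - t) sumℤ-reduced) (ℤP.+-inverseʳ (deg d)))

    congruent : ∀ j → j ≢ lst m → d j - reduced j ≡ c + + suc (suc m) * quotient j
    congruent j j≢lst = begin
      d j - reduced j
        ≡⟨ cong (λ r → d j - r) (reduced-off-lst j≢lst) ⟩
      d j - residue j
        ≡⟨ through-c (d j) c (residue j) ⟩
      c + ((d j - c) - residue j)
        ≡⟨ cong (λ t → c + (t - residue j)) (a≡a%ℕn+[a/ℕn]*n (d j - c) (suc (suc m))) ⟩
      c + ((residue j + quotient j * + suc (suc m)) - residue j)
        ≡⟨ cong (λ t → c + t) (drop (residue j) (quotient j) (+ suc (suc m))) ⟩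
      c + + suc (suc m) * quotient j
        ∎
      where
      through-c : ∀ x c r → x - r ≡ c + ((x - c) - r)
      through-c = solve-∀
      drop : ∀ r q N → (r + q * N) - r ≡ N * q
      drop = solve-∀

lemma6p6 : (m : ℕ) → (d : Vecℤ (suc (suc m))) →
    Σ (Vecℤ (suc (suc m))) λ a →
    InA m a
    × InImageΔ (suc (suc m)) (d -ᵥ a)
    × (∀ (a′ : Vecℤ (suc (suc m))) → InA m a′ → InImageΔ (suc (suc m)) (d -ᵥ a′) → ∀ i → a′ i ≡ a i)
    × (∀ (j : Fin (suc (suc m))) → toℕ j < m → a j ≡ + ((d j - d (pen m)) %ℕ suc (suc m)))
    × (a (pen m) ≡ + 0)
    × (a (lst m) ≡ deg d - sumBelow m a)
lemma6p6 m d =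
    reduced
  , reduced∈A
  , d-reduced∈imageΔ
  , (λ a′ a′∈A d-a′∈Im → InA-unique m {d} reduced∈A a′∈A d-reduced∈imageΔ d-a′∈Im)
  , (λ j → reduced-below)
  , reduced-pen
  , reduced-lst
  where open Reduction m d
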